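{- For $n\ge1$ and $0\le j\le n$, \[P_{n,j}(x)=(1+nx-x)P_{n-1,j}(x)+(x-x^2)P_{n-1,j}'(x)+nxP_{n-1,j-1}(x)+(x-x^2)P_{n-1,j-1}'(x),\] with the convention $P_{n-1,-1}=P_{n-1,n}=0$. Moreover $P_{n,0}(x)=P^{\mathrm{A}}_n(x)$ for $n\ge0$ and $P_{n,n}(x)=xP^{\mathrm{A}}_n(x)$ for $n\ge1$.
   Context: $\mathcal{B}_n$ is the set of signed permutations of order $n$: bijections $\sigma$ of $\{ -n,\ldots,n\}$ with $\sigma(-i)=-\sigma(i)$, identified with $(0,\sigma_1,\ldots,\sigma_n)$. $\mathrm{des}(\sigma)$ is the number of $i\in\{1,\ldots,n\}$ with $\sigma_{i-1}>\sigma_i$ ($\sigma_0=0$), $\mathrm{neg}(\sigma)$ the number of $i\in\{1,\ldots,n\}$ with $\sigma_i<0$. $B(n,k,j)$ is the number of $\sigma\in\mathcal{B}_n$ with $\mathrm{des}(\sigma)=k$, $\mathrm{neg}(\sigma)=j$. $P_{n,j}(x):=\sum_{k=0}^n B(n,k,j)x^k$. $P^{\mathrm{A}}_n(x):=\sum_{k=0}^n A(n,k)x^k$, where $A(n,k)$ is the number of permutations $(\tau_1,\ldots,\tau_n)$ of $\{1,\ldots,n\}$ with exactly $k$ indices $i$ with $\tau_i>\tau_{i+1}$ ($A(0,0)=1$). -}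

module Defs where

open import Data.Nat as ℕ using (ℕ; zero; suc)
open import Data.Integer as ℤ using (ℤ; +_; -[1+_]; ∣_∣)
open import Data.Bool using (Bool; true; false; _∧_; not; if_then_else_)
open import Data.List using (List; []; _∷_; length; filter; map; concatMap; upTo; all)
open import Relation.Nullary.Decidable using (⌊_⌋)
open import Relation.Unary using (Decidable)
open import Relation.Binary.PropositionalEquality using (_≡_)

words : List ℤ → ℕ → List (List ℤ)
words alph zero    = [] ∷ []
words alph (suc m) = concatMap (λ a → map (a ∷_) (words alph m)) alph

pos : ℕ → List ℤ
pos n = map (λ i → + suc i) (upTo n)

negs : ℕ → List ℤ
negs n = map (λ i → -[1+ i ]) (upTo n)

occursAbs : ℤ → List ℤ → Bool
occursAbs x []       = false
occursAbs x (y ∷ ys) = ⌊ ∣ x ∣ ℕ.≟ ∣ y ∣ ⌋ Data.Bool.∨ occursAbs x ys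
  where import Data.Bool

distinctAbs : List ℤ → Bool
distinctAbs []       = true
distinctAbs (x ∷ xs) = not (occursAbs x xs) ∧ distinctAbs xs

-- Signed permutations of order n, in window notation (σ₁,…,σₙ):
-- words of length n over {±1,…,±n} whose absolute values are distinct
-- (i.e. |σ| is a permutation of {1,…,n}).
signedPerms : ℕ → List (List ℤ)
signedPerms n = filter (λ w → Data.Bool.T? (distinctAbs w)) (words (pos n Data.List.++ negs n) n)
  where import Data.Bool; import Data.List

perms : ℕ → List (List ℤ)
perms n = filter (λ w → Data.Bool.T? (distinctAbs w)) (words (pos n) n)
  where import Data.Bool

descents : List ℤ → ℕ
descents []           = 0
descents (x ∷ [])     = 0
descents (x ∷ y ∷ ys) = (if ⌊ y ℤ.<? x ⌋ then 1 else 0) ℕ.+ descents (y ∷ ys)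

desB : List ℤ → ℕ
desB w = descents (+ 0 ∷ w)

neg : List ℤ → ℕ
neg []       = 0
neg (x ∷ xs) = (if ⌊ x ℤ.<? + 0 ⌋ then 1 else 0) ℕ.+ neg xs

count : {A : Set} → (A → Bool) → List A → ℕ
count p xs = length (filter (λ a → Data.Bool.T? (p a)) xs)
  where import Data.Bool

Bnum : ℕ → ℕ → ℕ → ℕ
Bnum n k j = count (λ σ → ⌊ desB σ ℕ.≟ k ⌋ ∧ ⌊ neg σ ℕ.≟ j ⌋) (signedPerms n)

Anum : ℕ → ℕ → ℕ
Anum n k = count (λ τ → ⌊ descents τ ℕ.≟ k ⌋) (perms n)

-- Polynomials in x with integer coefficients, as coefficient sequences
-- (p k = coefficient of x^k). All polynomials used here have finite support.

Poly : Set
Poly = ℕ → ℤ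

_≗ₚ_ : Poly → Poly → Set
p ≗ₚ q = ∀ k → p k ≡ q k
infix 4 _≗ₚ_

0ₚ : Poly
0ₚ _ = + 0

_⊕_ : Poly → Poly → Poly
(p ⊕ q) k = p k ℤ.+ q k
infixl 6 _⊕_

_⊖_ : Poly → Poly → Poly
(p ⊖ q) k = p k ℤ.- q k
infixl 6 _⊖_

_⊙_ : ℤ → Poly → Poly
(c ⊙ p) k = c ℤ.* p k
infixl 7 _⊙_

X· : Poly → Poly
X· p zero    = + 0
X· p (suc k) = p k

D : Poly → Poly
D p k = + suc k ℤ.* p (suc k)

P : ℕ → ℕ → Poly
P n j k = + Bnum n k j

PA : ℕ → Poly
PA n k = + Anum n k

Pprev : ℕ → ℕ → Poly
Pprev n zero    = 0ₚ
Pprev n (suc j) = P n j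

module Submission where

-- Every signed permutation of order m+1 arises exactly once by inserting m+1 or -(m+1) into one of
-- the m+1 gaps of a signed permutation σ of order m, read as the word 0σ₁…σₘ. With d = des σ,
-- inserting m+1 keeps des in the d descent gaps and at the end and raises it by one in the other
-- m-d gaps; inserting -(m+1) keeps des in the d descent gaps, raises it in the other m+1-d gaps,
-- and raises neg by one. Summing over σ,
--   B(m+1,k,j) = (k+1)B(m,k,j) + (m+1-k)B(m,k-1,j) + kB(m,k,j-1) + (m+2-k)B(m,k-1,j-1),
-- which is the coefficient of x^k on both sides of the recurrence.
-- A signed permutation with neg = 0 is an ordinary permutation with the same descents. One with
-- neg = n has only negative letters, so 0 > σ₁ is one extra descent, and x ↦ n+1+x maps it
-- order-preservingly onto an ordinary permutation.

open import Defs

open import Data.Bool using (Bool; true; false; T; _∧_; not; if_then_else_)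
open import Data.Bool.Properties using (∧-zeroʳ; T-∧)
open import Data.Empty using (⊥-elim)
open import Data.Integer as ℤ using (ℤ; +_; -[1+_]; ∣_∣)
import Data.Integer.Properties as ℤ
open import Data.Integer.Tactic.RingSolver using (solve-∀)
open import Data.List
  using (List; []; _∷_; length; filter; map; concatMap; replicate; _++_; cartesianProductWith)
open import Data.List.Membership.Propositional using (_∈_; find; lose)
open import Data.List.Membership.Propositional.Properties
  using (∈-map⁺; ∈-map⁻; ∈-concatMap⁺; ∈-concatMap⁻; ∈-++⁺ˡ; ∈-++⁺ʳ; ∈-++⁻; ∈-upTo⁺; ∈-upTo⁻;
         ∈-filter⁺; ∈-filter⁻; ∈-cartesianProductWith⁺; ∈-cartesianProductWith⁻)
open import Data.List.Membership.Propositional.Properties.WithK using (unique∧set⇒bag)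
open import Data.List.Properties
  using (filter-++; filter-accept; filter-reject; filter-all; filter-none; length-++; length-map;
         length-replicate; map-++; map-replicate; map-∘; map-cong; map-cong-local; map-id)
open import Data.List.Relation.Binary.BagAndSetEquality using (∼bag⇒↭)
open import Data.List.Relation.Binary.Permutation.Propositional
  using (_↭_; ↭-refl; ↭-sym; ↭-trans; ↭-reflexive; prep)
open import Data.List.Relation.Binary.Permutation.Propositional.Properties
  using (↭-length; filter-↭; shift) renaming (map⁺ to ↭-map⁺)
open import Data.List.Relation.Unary.All as All using (All; []; _∷_)
open import Data.List.Relation.Unary.All.Properties using (replicate⁺; ¬Any⇒All¬) renaming (map⁺ to All-map⁺)
open import Data.List.Relation.Unary.AllPairs using (AllPairs; []; _∷_)
open import Data.List.Relation.Unary.AllPairs.Properties using () renaming (map⁺ to AllPairs-map⁺)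
open import Data.List.Relation.Unary.Any using (Any; here; there; any?)
open import Data.List.Relation.Unary.Unique.Propositional using (Unique)
import Data.List.Relation.Unary.Unique.Propositional.Properties as Unique
open import Data.Nat as ℕ using (ℕ; zero; suc; _+_; _*_; _∸_; _≤_; _<_; _≡ᵇ_; z≤n; s≤s)
open import Data.Nat.ListAction using (sum)
import Data.Nat.Properties as ℕ
open import Algebra.Properties.CommutativeSemigroup ℕ.+-commutativeSemigroup using (interchange; x∙yz≈y∙xz)
open import Data.Product using (_×_; _,_; ∃; ∃₂; proj₁; proj₂; uncurry)
open import Data.Sum using (inj₁; inj₂)
open import Function using (_∘_; _on_)
open import Function.Bundles using (Equivalence; mk⇔)
open import Relation.Binary.Definitions using (Symmetric)
open import Relation.Binary.PropositionalEquality
open import Relation.Nullary using (¬_)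
open import Relation.Nullary.Decidable using (T?; yes; no; ¬?; ⌊_⌋; isYes≗does; dec-true; dec-false)

[_]·_ : Bool → ℕ → ℕ
[ true  ]· n = n
[ false ]· n = 0

module _ {A : Set} (p : A → Bool) where

  count-++ : ∀ xs ys → count p (xs ++ ys) ≡ count p xs + count p ys
  count-++ xs ys = trans (cong length (filter-++ (T? ∘ p) xs ys)) (length-++ (filter (T? ∘ p) xs))

  count-↭ : ∀ {xs ys} → xs ↭ ys → count p xs ≡ count p ys
  count-↭ xs↭ys = ↭-length (filter-↭ (T? ∘ p) xs↭ys)

  count-replicate : ∀ n x → count p (replicate n x) ≡ [ p x ]· n
  count-replicate n x with p x in px
  ... | true  = trans (cong length (filter-all (T? ∘ p) (replicate⁺ n (subst T (sym px) _))))
                      (length-replicate n)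
  ... | false = cong length (filter-none (T? ∘ p) (replicate⁺ n (subst T px)))

  count-none : ∀ {xs} → All (λ x → ¬ T (p x)) xs → count p xs ≡ 0
  count-none none = cong length (filter-none (T? ∘ p) none)

  count-map : ∀ {B : Set} (f : B → A) xs → count p (map f xs) ≡ count (p ∘ f) xs
  count-map f []       = refl
  count-map f (x ∷ xs) with p (f x)
  ... | true  = cong suc (count-map f xs)
  ... | false = count-map f xs

  count-concatMap : ∀ {B : Set} (f : B → List A) xs →
                    count p (concatMap f xs) ≡ sum (map (count p ∘ f) xs)
  count-concatMap f []       = refl
  count-concatMap f (x ∷ xs) =
    trans (count-++ (f x) (concatMap f xs)) (cong (λ n → count p (f x) + n) (count-concatMap f xs))

  count-∧ : ∀ (q : A → Bool) xs → count (λ x → p x ∧ q x) xs ≡ count p (filter (T? ∘ q) xs)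
  count-∧ q []       = refl
  count-∧ q (x ∷ xs) with q x
  ... | false rewrite ∧-zeroʳ (p x) = count-∧ q xs
  ... | true with p x
  ...   | true  = cong suc (count-∧ q xs)
  ...   | false = count-∧ q xs

count-cong : ∀ {A : Set} {p q : A → Bool} {xs} → All (λ x → p x ≡ q x) xs → count p xs ≡ count q xs
count-cong []                                  = refl
count-cong {p = p} {q} {x ∷ _} (_ ∷ eqs) with p x | q x
... | true  | true  = cong suc (count-cong eqs)
... | false | false = count-cong eqs
count-cong (() ∷ _) | true  | false
count-cong (() ∷ _) | false | true

module _ {A : Set} where

  sum-map-+ : ∀ (f g : A → ℕ) xs → sum (map (λ x → f x + g x) xs) ≡ sum (map f xs) + sum (map g xs)
  sum-map-+ f g []       = refl
  sum-map-+ f g (x ∷ xs) =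
    trans (cong (λ n → f x + g x + n) (sum-map-+ f g xs)) (interchange (f x) (g x) _ _)

  sum-map-[]· : ∀ (p : A → Bool) c xs → sum (map (λ x → [ p x ]· c) xs) ≡ c * count p xs
  sum-map-[]· p c []       = sym (ℕ.*-zeroʳ c)
  sum-map-[]· p c (x ∷ xs) with p x
  ... | true  = trans (cong (λ n → c + n) (sum-map-[]· p c xs)) (sym (ℕ.*-suc c _))
  ... | false = sum-map-[]· p c xs

[≡ᵇ]·-at : ∀ a k b (f : ℕ → ℕ) → [ (a ≡ᵇ k) ∧ b ]· f a ≡ [ (a ≡ᵇ k) ∧ b ]· f k
[≡ᵇ]·-at a k b f with a ≡ᵇ k in a≡ᵇk
... | false = refl
... | true rewrite ℕ.≡ᵇ⇒≡ a k (subst T (sym a≡ᵇk) _) = refl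

sum-map-[≡ᵇ]· : ∀ {A : Set} (g : A → ℕ) (q : A → Bool) (f : ℕ → ℕ) k xs →
                sum (map (λ x → [ (g x ≡ᵇ k) ∧ q x ]· f (g x)) xs)
                ≡ f k * count (λ x → (g x ≡ᵇ k) ∧ q x) xs
sum-map-[≡ᵇ]· g q f k xs =
  trans (cong sum (map-cong (λ x → [≡ᵇ]·-at (g x) k (q x) f) xs))
        (sum-map-[]· (λ x → (g x ≡ᵇ k) ∧ q x) (f k) xs)

unique∧⇔⇒↭ : ∀ {A : Set} {xs ys : List A} → Unique xs → Unique ys →
             (∀ {z} → z ∈ xs → z ∈ ys) → (∀ {z} → z ∈ ys → z ∈ xs) → xs ↭ ys
unique∧⇔⇒↭ uxs uys to from = ∼bag⇒↭ (unique∧set⇒bag uxs uys (mk⇔ to from))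

concatMap-unique : ∀ {A B : Set} (f : A → List B) (r : B → A) {xs} → Unique xs →
                   (∀ {x} → x ∈ xs → Unique (f x)) →
                   (∀ {x z} → x ∈ xs → z ∈ f x → r z ≡ x) →
                   Unique (concatMap f xs)
concatMap-unique f r {[]}     []           _       _       = []
concatMap-unique f r {x ∷ xs} (x∉xs ∷ uxs) unique-f r-inverse =
  Unique.++⁺ (unique-f (here refl))
             (concatMap-unique f r uxs (unique-f ∘ there) (r-inverse ∘ there))
             disjoint
  where
  disjoint : ∀ {z} → ¬ (z ∈ f x × z ∈ concatMap f xs)
  disjoint (z∈fx , z∈rest) with y , y∈xs , z∈fy ← find (∈-concatMap⁻ f {xs = xs} z∈rest) =
    All.lookup x∉xs y∈xs (trans (sym (r-inverse (here refl) z∈fx)) (r-inverse (there y∈xs) z∈fy))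

AllPairs-map-All : ∀ {A B : Set} {P : A → Set} {R : A → A → Set} {S : B → B → Set} (f : A → B) →
                   (∀ {x y} → P x → P y → R x y → S (f x) (f y)) →
                   ∀ {xs} → All P xs → AllPairs R xs → AllPairs S (map f xs)
AllPairs-map-All f preserves []         []         = []
AllPairs-map-All f preserves (px ∷ pxs) (rx ∷ rxs) =
  All-map⁺ (All.zipWith (λ (py , r) → preserves px py r) (pxs , rx)) ∷ AllPairs-map-All f preserves pxs rxs

data Insert {A : Set} (a : A) : List A → List A → Set where
  here  : ∀ {xs} → Insert a xs (a ∷ xs)
  there : ∀ {x xs ys} → Insert a xs ys → Insert a (x ∷ xs) (x ∷ ys)

module _ {A : Set} where

  inserts : A → List A → List (List A)
  inserts a []       = (a ∷ []) ∷ []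
  inserts a (x ∷ xs) = (a ∷ x ∷ xs) ∷ map (x ∷_) (inserts a xs)

  ∈-inserts⁺ : ∀ {a : A} {xs ys} → Insert a xs ys → ys ∈ inserts a xs
  ∈-inserts⁺ {xs = []}    here      = here refl
  ∈-inserts⁺ {xs = _ ∷ _} here      = here refl
  ∈-inserts⁺              (there i) = there (∈-map⁺ _ (∈-inserts⁺ i))

  ∈-inserts⁻ : ∀ (a : A) xs {ys} → ys ∈ inserts a xs → Insert a xs ys
  ∈-inserts⁻ a []       (here refl) = here
  ∈-inserts⁻ a (x ∷ xs) (here refl) = here
  ∈-inserts⁻ a (x ∷ xs) (there ys∈) with _ , vs∈ , refl ← ∈-map⁻ _ ys∈ = there (∈-inserts⁻ a xs vs∈)

  inserts-unique : ∀ {a : A} {xs} → All (a ≢_) xs → Unique (inserts a xs)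
  inserts-unique {xs = []}    []           = [] ∷ []
  inserts-unique {a} {x ∷ xs} (a≢x ∷ a≢xs) =
    All.tabulate head≢ ∷ Unique.map⁺ (λ { refl → refl }) (inserts-unique a≢xs)
    where
    head≢ : ∀ {ys} → ys ∈ map (x ∷_) (inserts a xs) → a ∷ x ∷ xs ≢ ys
    head≢ ys∈ with _ , _ , refl ← ∈-map⁻ _ ys∈ = λ { refl → a≢x refl }

  Insert-length : ∀ {a : A} {xs ys} → Insert a xs ys → length ys ≡ suc (length xs)
  Insert-length here      = refl
  Insert-length (there i) = cong suc (Insert-length i)

  Insert⇒∈ : ∀ {a : A} {xs ys} → Insert a xs ys → a ∈ ys
  Insert⇒∈ here      = here refl
  Insert⇒∈ (there i) = there (Insert⇒∈ i)

  Any⇒Insert : ∀ {P : A → Set} {ys} → Any P ys → ∃₂ λ a xs → P a × Insert a xs ys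
  Any⇒Insert (here pa)   = _ , _ , pa , here
  Any⇒Insert (there any) with a , xs , pa , i ← Any⇒Insert any = a , _ , pa , there i

  module _ {P : A → Set} where

    All-Insert⁺ : ∀ {a xs ys} → P a → All P xs → Insert a xs ys → All P ys
    All-Insert⁺ pa pxs        here      = pa ∷ pxs
    All-Insert⁺ pa (px ∷ pxs) (there i) = px ∷ All-Insert⁺ pa pxs i

    All-Insert⁻ : ∀ {a xs ys} → All P ys → Insert a xs ys → P a × All P xs
    All-Insert⁻ (pa ∷ pxs) here      = pa , pxs
    All-Insert⁻ (px ∷ pys) (there i) = let pa , pxs = All-Insert⁻ pys i in pa , px ∷ pxs

  module _ {R : A → A → Set} (sym-R : Symmetric R) where

    AllPairs-Insert⁺ : ∀ {a xs ys} → All (R a) xs → AllPairs R xs → Insert a xs ys → AllPairs R ys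
    AllPairs-Insert⁺ Ra         rxs        here      = Ra ∷ rxs
    AllPairs-Insert⁺ (Rax ∷ Ra) (Rx ∷ rxs) (there i) =
      All-Insert⁺ (sym-R Rax) Rx i ∷ AllPairs-Insert⁺ Ra rxs i

    AllPairs-Insert⁻ : ∀ {a xs ys} → AllPairs R ys → Insert a xs ys → All (R a) xs × AllPairs R xs
    AllPairs-Insert⁻ (Ra ∷ rxs) here      = Ra , rxs
    AllPairs-Insert⁻ (Rx ∷ rys) (there i) =
      let Rxa , Rx′ = All-Insert⁻ Rx i
          Ra , rxs  = AllPairs-Insert⁻ rys i
      in sym-R Rxa ∷ Ra , Rx′ ∷ rxs

InRange : ℕ → ℕ → Set
InRange n k = 0 < k × k ≤ n

InRange-shrink : ∀ {n k} → InRange (suc n) k → k ≢ suc n → InRange n k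
InRange-shrink (0<k , k≤n+1) k≢n+1 = 0<k , ℕ.≤-pred (ℕ.≤∧≢⇒< k≤n+1 k≢n+1)

unique⇒length≤ : ∀ n {ks} → Unique ks → All (InRange n) ks → length ks ≤ n
unique⇒length≤ zero    {[]}    _ _                 = z≤n
unique⇒length≤ zero    {_ ∷ _} _ ((0<k , k≤0) ∷ _) = ⊥-elim (ℕ.<⇒≱ 0<k k≤0)
unique⇒length≤ (suc n) {ks}    u inRange with any? (ℕ._≟ suc n) ks
... | yes n+1∈ks with _ , ks′ , refl , i ← Any⇒Insert n+1∈ks =
  let n+1≢ks′ , u′ = AllPairs-Insert⁻ ≢-sym u i
      inRange′     = All.zipWith (uncurry InRange-shrink)
                                 (proj₂ (All-Insert⁻ inRange i) , All.map ≢-sym n+1≢ks′)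
  in subst (_≤ suc n) (sym (Insert-length i)) (s≤s (unique⇒length≤ n u′ inRange′))
... | no n+1∉ks =
  ℕ.m≤n⇒m≤1+n (unique⇒length≤ n u (All.zipWith (uncurry InRange-shrink) (inRange , ¬Any⇒All¬ ks n+1∉ks)))

InRange-reflect : ∀ {n a} → InRange n a → InRange n (suc n ∸ a)
InRange-reflect {n} {suc a} (_ , a<n) = ℕ.m<n⇒0<n∸m a<n , ℕ.m∸n≤m n a

reflect-injective : ∀ {n a b} → InRange n a → InRange n b → suc n ∸ a ≡ suc n ∸ b → a ≡ b
reflect-injective (_ , a≤n) (_ , b≤n) = ℕ.∸-cancelˡ-≡ (ℕ.m≤n⇒m≤1+n a≤n) (ℕ.m≤n⇒m≤1+n b≤n)

Distinct : List ℤ → Set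
Distinct = AllPairs (_≢_ on ∣_∣)

¬occursAbs⇒All≢ : ∀ x ys → T (not (occursAbs x ys)) → All (λ y → ∣ x ∣ ≢ ∣ y ∣) ys
¬occursAbs⇒All≢ x []       _ = []
¬occursAbs⇒All≢ x (y ∷ ys) t with ∣ x ∣ ℕ.≟ ∣ y ∣
... | no x≢y = x≢y ∷ ¬occursAbs⇒All≢ x ys t

All≢⇒¬occursAbs : ∀ x {ys} → All (λ y → ∣ x ∣ ≢ ∣ y ∣) ys → T (not (occursAbs x ys))
All≢⇒¬occursAbs x {[]}     []             = _
All≢⇒¬occursAbs x {y ∷ ys} (x≢y ∷ x≢ys) with ∣ x ∣ ℕ.≟ ∣ y ∣
... | yes x≡y = x≢y x≡y
... | no _    = All≢⇒¬occursAbs x x≢ys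

distinctAbs⇒Distinct : ∀ w → T (distinctAbs w) → Distinct w
distinctAbs⇒Distinct []       _ = []
distinctAbs⇒Distinct (x ∷ xs) t =
  let t₁ , t₂ = Equivalence.to T-∧ t in ¬occursAbs⇒All≢ x xs t₁ ∷ distinctAbs⇒Distinct xs t₂

Distinct⇒distinctAbs : ∀ {w} → Distinct w → T (distinctAbs w)
Distinct⇒distinctAbs []              = _
Distinct⇒distinctAbs {x ∷ _} (x≢xs ∷ d) =
  Equivalence.from T-∧ (All≢⇒¬occursAbs x x≢xs , Distinct⇒distinctAbs d)

Letter : ℕ → ℤ → Set
Letter n x = InRange n ∣ x ∣

∈-alphabet⁻ : ∀ {n x} → x ∈ pos n ++ negs n → Letter n x
∈-alphabet⁻ {n} x∈ with ∈-++⁻ (pos n) x∈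
... | inj₁ x∈pos with _ , i∈ , refl ← ∈-map⁻ _ x∈pos = s≤s z≤n , ∈-upTo⁻ i∈
... | inj₂ x∈neg with _ , i∈ , refl ← ∈-map⁻ _ x∈neg = s≤s z≤n , ∈-upTo⁻ i∈

∈-alphabet⁺ : ∀ {n x} → Letter n x → x ∈ pos n ++ negs n
∈-alphabet⁺ {n} {+ suc i}  (_ , i<n) = ∈-++⁺ˡ (∈-map⁺ _ (∈-upTo⁺ i<n))
∈-alphabet⁺ {n} { -[1+ i ]} (_ , i<n) = ∈-++⁺ʳ (pos n) (∈-map⁺ _ (∈-upTo⁺ i<n))

∈-pos⁻ : ∀ {n x} → x ∈ pos n → ∃ λ i → i < n × x ≡ + suc i
∈-pos⁻ x∈ with i , i∈ , refl ← ∈-map⁻ _ x∈ = i , ∈-upTo⁻ i∈ , refl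

∈-pos⁺ : ∀ {n i} → i < n → + suc i ∈ pos n
∈-pos⁺ i<n = ∈-map⁺ _ (∈-upTo⁺ i<n)

words-suc : ∀ alph n → words alph (suc n) ≡ cartesianProductWith _∷_ alph (words alph n)
words-suc alph n = concatMap≡cartesian alph
  where
  concatMap≡cartesian : ∀ as → concatMap (λ a → map (a ∷_) (words alph n)) as
                              ≡ cartesianProductWith _∷_ as (words alph n)
  concatMap≡cartesian []       = refl
  concatMap≡cartesian (a ∷ as) = cong (map (a ∷_) (words alph n) ++_) (concatMap≡cartesian as)

∈-words⁻ : ∀ alph n {w} → w ∈ words alph n → length w ≡ n × All (_∈ alph) w
∈-words⁻ alph zero    (here refl) = refl , []
∈-words⁻ alph (suc n) w∈ rewrite words-suc alph n
  with a , v , a∈ , v∈ , refl ← ∈-cartesianProductWith⁻ _∷_ alph (words alph n) w∈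
  with refl , v⊆ ← ∈-words⁻ alph n v∈ = refl , a∈ ∷ v⊆

∈-words⁺ : ∀ {alph w} → All (_∈ alph) w → w ∈ words alph (length w)
∈-words⁺               []         = here refl
∈-words⁺ {alph} {_ ∷ v} (a∈ ∷ v⊆) rewrite words-suc alph (length v) =
  ∈-cartesianProductWith⁺ _∷_ a∈ (∈-words⁺ v⊆)

words-unique : ∀ {alph} n → Unique alph → Unique (words alph n)
words-unique           zero    _ = [] ∷ []
words-unique {alph} (suc n) u rewrite words-suc alph n =
  Unique.cartesianProductWith⁺ _∷_ (λ { refl → refl , refl }) u (words-unique n u)

IsSignedPerm : ℕ → List ℤ → Set
IsSignedPerm n w = length w ≡ n × All (Letter n) w × Distinct w

IsPerm : ℕ → List ℤ → Set
IsPerm n w = length w ≡ n × All (_∈ pos n) w × Distinct w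

∈-signedPerms⁻ : ∀ {n w} → w ∈ signedPerms n → IsSignedPerm n w
∈-signedPerms⁻ {n} w∈ with w∈words , t ← ∈-filter⁻ (T? ∘ distinctAbs) {xs = words (pos n ++ negs n) n} w∈
  with len , w⊆ ← ∈-words⁻ _ n w∈words = len , All.map ∈-alphabet⁻ w⊆ , distinctAbs⇒Distinct _ t

∈-signedPerms⁺ : ∀ {n w} → IsSignedPerm n w → w ∈ signedPerms n
∈-signedPerms⁺ (refl , letters , d) =
  ∈-filter⁺ (T? ∘ distinctAbs) (∈-words⁺ (All.map ∈-alphabet⁺ letters)) (Distinct⇒distinctAbs d)

∈-perms⁻ : ∀ {n w} → w ∈ perms n → IsPerm n w
∈-perms⁻ {n} w∈ with w∈words , t ← ∈-filter⁻ (T? ∘ distinctAbs) {xs = words (pos n) n} w∈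
  with len , w⊆ ← ∈-words⁻ _ n w∈words = len , w⊆ , distinctAbs⇒Distinct _ t

∈-perms⁺ : ∀ {n w} → IsPerm n w → w ∈ perms n
∈-perms⁺ (refl , w⊆ , d) = ∈-filter⁺ (T? ∘ distinctAbs) (∈-words⁺ w⊆) (Distinct⇒distinctAbs d)

pos-unique : ∀ n → Unique (pos n)
pos-unique n = Unique.map⁺ (λ { refl → refl }) (Unique.upTo⁺ n)

signedPerms-unique : ∀ n → Unique (signedPerms n)
signedPerms-unique n = Unique.filter⁺ (T? ∘ distinctAbs) (words-unique n alphabet-unique)
  where
  pos∩negs≡∅ : ∀ {x} → ¬ (x ∈ pos n × x ∈ negs n)
  pos∩negs≡∅ (x∈pos , x∈negs) with _ , _ , refl ← ∈-pos⁻ x∈pos with _ , _ , () ← ∈-map⁻ _ x∈negs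

  alphabet-unique : Unique (pos n ++ negs n)
  alphabet-unique = Unique.++⁺ (pos-unique n) (Unique.map⁺ (λ { refl → refl }) (Unique.upTo⁺ n)) pos∩negs≡∅

perms-unique : ∀ n → Unique (perms n)
perms-unique n = Unique.filter⁺ (T? ∘ distinctAbs) (words-unique n (pos-unique n))

InRange⇒∈pos : ∀ {n k} → InRange n k → + k ∈ pos n
InRange⇒∈pos {k = suc _} (_ , k≤n) = ∈-pos⁺ k≤n

⌊<?⌋-true : ∀ {x y} → x ℤ.< y → ⌊ x ℤ.<? y ⌋ ≡ true
⌊<?⌋-true {x} {y} x<y = trans (isYes≗does (x ℤ.<? y)) (dec-true (x ℤ.<? y) x<y)

⌊<?⌋-false : ∀ {x y} → ¬ x ℤ.< y → ⌊ x ℤ.<? y ⌋ ≡ false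
⌊<?⌋-false {x} {y} x≮y = trans (isYes≗does (x ℤ.<? y)) (dec-false (x ℤ.<? y) x≮y)

negative : ℤ → ℕ
negative x = if ⌊ x ℤ.<? + 0 ⌋ then 1 else 0

neg-Insert : ∀ {a σ w} → Insert a σ w → neg w ≡ negative a + neg σ
neg-Insert here                  = refl
neg-Insert {a} (there {x} {σ} i) =
  trans (cong (λ n → negative x + n) (neg-Insert i)) (x∙yz≈y∙xz (negative x) (negative a) (neg σ))

neg≤length : ∀ σ → neg σ ≤ length σ
neg≤length []      = z≤n
neg≤length (x ∷ σ) with ⌊ x ℤ.<? + 0 ⌋
... | true  = s≤s (neg≤length σ)
... | false = ℕ.m≤n⇒m≤1+n (neg≤length σ)

neg≡0⇒ : ∀ σ → neg σ ≡ 0 → All (λ x → negative x ≡ 0) σ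
neg≡0⇒ []      _  = []
neg≡0⇒ (x ∷ σ) eq = ℕ.m+n≡0⇒m≡0 (negative x) eq ∷ neg≡0⇒ σ (ℕ.m+n≡0⇒n≡0 (negative x) eq)

neg≡0⇐ : ∀ {σ} → All (λ x → negative x ≡ 0) σ → neg σ ≡ 0
neg≡0⇐ []          = refl
neg≡0⇐ (eq ∷ eqs) = cong₂ _+_ eq (neg≡0⇐ eqs)

neg≡length⇒ : ∀ σ → neg σ ≡ length σ → All (λ x → negative x ≡ 1) σ
neg≡length⇒ []      _  = []
neg≡length⇒ (x ∷ σ) eq with ⌊ x ℤ.<? + 0 ⌋ in x<0
... | true  = cong (λ b → if b then 1 else 0) x<0 ∷ neg≡length⇒ σ (ℕ.suc-injective eq)
... | false = ⊥-elim (ℕ.1+n≰n (subst (_≤ length σ) eq (neg≤length σ)))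

neg≡length⇐ : ∀ {σ} → All (λ x → negative x ≡ 1) σ → neg σ ≡ length σ
neg≡length⇐ []          = refl
neg≡length⇐ (eq ∷ eqs) = cong₂ _+_ eq (neg≡length⇐ eqs)

∈-pos⇒ : ∀ {n x} → x ∈ pos n → Letter n x × negative x ≡ 0
∈-pos⇒ x∈ with _ , i<n , refl ← ∈-pos⁻ x∈ = (s≤s z≤n , i<n) , refl

∈-pos⇐ : ∀ {n x} → Letter n x → negative x ≡ 0 → x ∈ pos n
∈-pos⇐ {x = + suc _} (_ , i<n) _ = ∈-pos⁺ i<n
∈-pos⇐ {x = + zero}  (() , _)  _

descents-≤ : ∀ x ys → descents (x ∷ ys) ≤ length ys
descents-≤ x []       = z≤n
descents-≤ x (y ∷ ys) with ⌊ y ℤ.<? x ⌋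
... | true  = s≤s (descents-≤ y ys)
... | false = ℕ.m≤n⇒m≤1+n (descents-≤ y ys)

desB-nonnegative : ∀ {τ} → All (λ x → negative x ≡ 0) τ → desB τ ≡ descents τ
desB-nonnegative []         = refl
desB-nonnegative {x ∷ τ} (eq ∷ _) = cong (λ n → n + descents (x ∷ τ)) eq

desB-negative : ∀ {x τ} → negative x ≡ 1 → desB (x ∷ τ) ≡ suc (descents (x ∷ τ))
desB-negative {x} {τ} eq = cong (λ n → n + descents (x ∷ τ)) eq

-- Signed permutations of order m + 1 from those of order m

extensions : ℕ → List ℤ → List (List ℤ)
extensions m σ = inserts (+ suc m) σ ++ inserts -[1+ m ] σ

∈-extensions⁻ : ∀ {m σ z} → z ∈ extensions m σ → ∃ λ a → ∣ a ∣ ≡ suc m × Insert a σ z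
∈-extensions⁻ {m} {σ} z∈ with ∈-++⁻ (inserts (+ suc m) σ) z∈
... | inj₁ z∈⁺ = + suc m  , refl , ∈-inserts⁻ _ σ z∈⁺
... | inj₂ z∈⁻ = -[1+ m ] , refl , ∈-inserts⁻ _ σ z∈⁻

∈-extensions⁺ : ∀ {m σ z a} → ∣ a ∣ ≡ suc m → Insert a σ z → z ∈ extensions m σ
∈-extensions⁺         {a = + _}      refl i = ∈-++⁺ˡ (∈-inserts⁺ i)
∈-extensions⁺ {m} {σ} {a = -[1+ _ ]} refl i = ∈-++⁺ʳ (inserts (+ suc m) σ) (∈-inserts⁺ i)

Letters⇒≢suc : ∀ {m σ} → All (Letter m) σ → All (λ y → ∣ y ∣ ≢ suc m) σ
Letters⇒≢suc {m} = All.map λ (_ , y≤m) y≡ → ℕ.1+n≰n (subst (_≤ m) y≡ y≤m)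

IsSignedPerm-Insert⁺ : ∀ {m σ a w} → IsSignedPerm m σ → ∣ a ∣ ≡ suc m → Insert a σ w → IsSignedPerm (suc m) w
IsSignedPerm-Insert⁺ {m} (refl , letters , d) ∣a∣≡ i =
  Insert-length i ,
  All-Insert⁺ (subst (InRange (suc m)) (sym ∣a∣≡) (s≤s z≤n , ℕ.≤-refl))
              (All.map (λ {y} (0<y , y≤m) → 0<y , ℕ.m≤n⇒m≤1+n y≤m) letters) i ,
  AllPairs-Insert⁺ ≢-sym (All.map (λ y≢ a≡y → y≢ (trans (sym a≡y) ∣a∣≡)) (Letters⇒≢suc letters)) d i

IsSignedPerm-Insert⁻ : ∀ {m w} → IsSignedPerm (suc m) w →
              ∃₂ λ a σ → ∣ a ∣ ≡ suc m × Insert a σ w × IsSignedPerm m σ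
IsSignedPerm-Insert⁻ {m} {w} (len , letters , d) with any? (λ x → ∣ x ∣ ℕ.≟ suc m) w
... | no no-top =
  ⊥-elim (ℕ.1+n≰n (subst (_≤ m) (trans (length-map ∣_∣ w) len)
    (unique⇒length≤ m (AllPairs-map⁺ d)
      (All-map⁺ (All.zipWith (uncurry InRange-shrink) (letters , ¬Any⇒All¬ w no-top))))))
... | yes top with a , σ , ∣a∣≡ , i ← Any⇒Insert top =
  let a≢σ , dσ = AllPairs-Insert⁻ ≢-sym d i
      lettersσ = proj₂ (All-Insert⁻ letters i)
  in a , σ , ∣a∣≡ , i ,
     ℕ.suc-injective (trans (sym (Insert-length i)) len) ,
     All.zipWith (uncurry InRange-shrink) (lettersσ , All.map (λ a≢y y≡ → a≢y (trans ∣a∣≡ (sym y≡))) a≢σ) ,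
     dσ

removeAbs : ℕ → List ℤ → List ℤ
removeAbs N = filter (λ x → ¬? (∣ x ∣ ℕ.≟ N))

removeAbs-Insert : ∀ {N a σ w} → ∣ a ∣ ≡ N → All (λ y → ∣ y ∣ ≢ N) σ → Insert a σ w → removeAbs N w ≡ σ
removeAbs-Insert {N} {a} {σ} ∣a∣≡N σ≢N here =
  trans (filter-reject (λ x → ¬? (∣ x ∣ ℕ.≟ N)) {a} {σ} (λ ∣a∣≢N → ∣a∣≢N ∣a∣≡N))
        (filter-all (λ x → ¬? (∣ x ∣ ℕ.≟ N)) σ≢N)
removeAbs-Insert {N} ∣a∣≡N (x≢N ∷ σ≢N) (there {x} {ys = w} i) =
  trans (filter-accept (λ x → ¬? (∣ x ∣ ℕ.≟ N)) {x} {w} x≢N) (cong (_ ∷_) (removeAbs-Insert ∣a∣≡N σ≢N i))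

extensions-unique : ∀ {m σ} → IsSignedPerm m σ → Unique (extensions m σ)
extensions-unique {m} {σ} (_ , letters , _) =
  Unique.++⁺ (inserts-unique (top≢σ refl)) (inserts-unique (top≢σ refl)) disjoint
  where
  top≢σ : ∀ {a} → ∣ a ∣ ≡ suc m → All (a ≢_) σ
  top≢σ ∣a∣≡ = All.map (λ y≢ a≡y → y≢ (trans (cong ∣_∣ (sym a≡y)) ∣a∣≡)) (Letters⇒≢suc letters)

  disjoint : ∀ {z} → ¬ (z ∈ inserts (+ suc m) σ × z ∈ inserts -[1+ m ] σ)
  disjoint (z∈⁺ , z∈⁻) =
    All.lookup (All-Insert⁺ (λ ()) (All.map ≢-sym (top≢σ refl)) (∈-inserts⁻ _ σ z∈⁻))
               (Insert⇒∈ (∈-inserts⁻ _ σ z∈⁺)) refl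

signedPerms-suc↭ : ∀ m → signedPerms (suc m) ↭ concatMap (extensions m) (signedPerms m)
signedPerms-suc↭ m =
  unique∧⇔⇒↭ (signedPerms-unique (suc m))
    (concatMap-unique (extensions m) (removeAbs (suc m)) (signedPerms-unique m)
                      (extensions-unique ∘ ∈-signedPerms⁻) removeAbs-extension)
    to from
  where
  removeAbs-extension : ∀ {σ z} → σ ∈ signedPerms m → z ∈ extensions m σ → removeAbs (suc m) z ≡ σ
  removeAbs-extension σ∈ z∈ with a , ∣a∣≡ , i ← ∈-extensions⁻ z∈ =
    removeAbs-Insert ∣a∣≡ (Letters⇒≢suc (proj₁ (proj₂ (∈-signedPerms⁻ σ∈)))) i

  to : ∀ {z} → z ∈ signedPerms (suc m) → z ∈ concatMap (extensions m) (signedPerms m)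
  to z∈ with _ , _ , ∣a∣≡ , i , σ-perm ← IsSignedPerm-Insert⁻ (∈-signedPerms⁻ z∈) =
    ∈-concatMap⁺ (extensions m) (lose (∈-signedPerms⁺ σ-perm) (∈-extensions⁺ ∣a∣≡ i))

  from : ∀ {z} → z ∈ concatMap (extensions m) (signedPerms m) → z ∈ signedPerms (suc m)
  from z∈ with _ , σ∈ , z∈ext ← find (∈-concatMap⁻ (extensions m) {xs = signedPerms m} z∈)
          with _ , ∣a∣≡ , i   ← ∈-extensions⁻ z∈ext =
    ∈-signedPerms⁺ (IsSignedPerm-Insert⁺ (∈-signedPerms⁻ σ∈) ∣a∣≡ i)

-- Descents after inserting an extreme letter

descents-map-cons : ∀ x y vs → map (λ v → descents (x ∷ v)) (map (y ∷_) vs)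
                              ≡ map (λ v → (if ⌊ y ℤ.<? x ⌋ then 1 else 0) + descents (y ∷ v)) vs
descents-map-cons x y vs = sym (map-∘ vs)

profile : ℕ → ℕ → ℕ → List ℕ
profile r s d = replicate r d ++ replicate s (suc d)

profile-cons-top : ∀ {ds} r s d → ds ↭ profile r s d → suc d ∷ ds ↭ profile r (suc s) d
profile-cons-top r s d ds↭ =
  ↭-trans (prep (suc d) ds↭) (↭-sym (shift (suc d) (replicate r d) (replicate s (suc d))))

profile-cons-suc : ∀ {ds} r s d → ds ↭ profile r s d → suc d ∷ map suc ds ↭ profile (suc r) s (suc d)
profile-cons-suc r s d ds↭ =
  prep (suc d) (↭-trans (↭-map⁺ suc ds↭)
    (↭-reflexive (trans (map-++ suc (replicate r d) _)
                        (cong₂ _++_ (map-replicate suc r d) (map-replicate suc s (suc d))))))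

descents-inserts-max : ∀ N x ys → All (ℤ._< N) (x ∷ ys) →
                       map (λ v → descents (x ∷ v)) (inserts N ys)
                       ↭ profile (suc (descents (x ∷ ys))) (length ys ∸ descents (x ∷ ys)) (descents (x ∷ ys))
descents-inserts-max N x []       (x<N ∷ []) rewrite ⌊<?⌋-false (ℤ.<-asym x<N) = ↭-refl
descents-inserts-max N x (y ∷ ys) (x<N ∷ y∷ys<N)
  rewrite ⌊<?⌋-false (ℤ.<-asym x<N) | ⌊<?⌋-true (All.head y∷ys<N) | descents-map-cons x y (inserts N ys)
  with ⌊ y ℤ.<? x ⌋ | descents-inserts-max N y ys y∷ys<N
... | false | ih = subst (λ s → suc d ∷ map (λ v → descents (y ∷ v)) (inserts N ys) ↭ profile (suc d) s d)
                         (sym (ℕ.+-∸-assoc 1 (descents-≤ y ys)))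
                         (profile-cons-top (suc d) (length ys ∸ d) d ih)
  where d = descents (y ∷ ys)
... | true  | ih = ↭-trans (↭-reflexive (cong (suc d ∷_) (map-∘ (inserts N ys))))
                          (profile-cons-suc (suc d) (length ys ∸ d) d ih)
  where d = descents (y ∷ ys)

descents-inserts-min : ∀ N x ys → All (N ℤ.<_) (x ∷ ys) →
                       map (λ v → descents (x ∷ v)) (inserts N ys)
                       ↭ profile (descents (x ∷ ys)) (suc (length ys) ∸ descents (x ∷ ys)) (descents (x ∷ ys))
descents-inserts-min N x []       (N<x ∷ []) rewrite ⌊<?⌋-true N<x = ↭-refl
descents-inserts-min N x (y ∷ ys) (N<x ∷ y∷ys>N)
  rewrite ⌊<?⌋-true N<x | ⌊<?⌋-false (ℤ.<-asym (All.head y∷ys>N)) | descents-map-cons x y (inserts N ys)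
  with ⌊ y ℤ.<? x ⌋ | descents-inserts-min N y ys y∷ys>N
... | false | ih = subst (λ s → suc d ∷ map (λ v → descents (y ∷ v)) (inserts N ys) ↭ profile d s d)
                         (sym (ℕ.+-∸-assoc 1 (ℕ.m≤n⇒m≤1+n (descents-≤ y ys))))
                         (profile-cons-top d (suc (length ys) ∸ d) d ih)
  where d = descents (y ∷ ys)
... | true  | ih = ↭-trans (↭-reflexive (cong (suc d ∷_) (map-∘ (inserts N ys))))
                          (profile-cons-suc d (suc (length ys) ∸ d) d ih)
  where d = descents (y ∷ ys)

-- The recurrence

Letter⇒<top : ∀ {m y} → Letter m y → y ℤ.< + suc m
Letter⇒<top {y = + _}      (_ , y≤m) = ℤ.+<+ (s≤s y≤m)
Letter⇒<top {y = -[1+ _ ]} _         = ℤ.-<+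

Letter⇒>bottom : ∀ {m y} → Letter m y → -[1+ m ] ℤ.< y
Letter⇒>bottom {y = + _}      _         = ℤ.-<+
Letter⇒>bottom {y = -[1+ _ ]} (_ , y≤m) = ℤ.-<- y≤m

desNeg : ℕ → ℕ → List ℤ → Bool
desNeg k j σ = (desB σ ≡ᵇ k) ∧ (neg σ ≡ᵇ j)

count-profile : ∀ {ws ν r s d} k j → All (λ w → neg w ≡ ν) ws → map desB ws ↭ profile r s d →
                count (desNeg k j) ws ≡ [ (d ≡ᵇ k) ∧ (ν ≡ᵇ j) ]· r + [ (suc d ≡ᵇ k) ∧ (ν ≡ᵇ j) ]· s
count-profile {ws} {ν} {r} {s} {d} k j negs≡ν desBs↭ = begin
  count (desNeg k j) ws
    ≡⟨ count-cong (All.map (λ {w} → cong (λ n → (desB w ≡ᵇ k) ∧ (n ≡ᵇ j))) negs≡ν) ⟩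
  count (at-ν ∘ desB) ws
    ≡⟨ count-map at-ν desB ws ⟨
  count at-ν (map desB ws)
    ≡⟨ count-↭ at-ν desBs↭ ⟩
  count at-ν (replicate r d ++ replicate s (suc d))
    ≡⟨ count-++ at-ν (replicate r d) _ ⟩
  count at-ν (replicate r d) + count at-ν (replicate s (suc d))
    ≡⟨ cong₂ _+_ (count-replicate at-ν r d) (count-replicate at-ν s (suc d)) ⟩
  [ at-ν d ]· r + [ at-ν (suc d) ]· s ∎
  where
  open ≡-Reasoning
  at-ν : ℕ → Bool
  at-ν e = (e ≡ᵇ k) ∧ (ν ≡ᵇ j)

count-extensions : ∀ {m σ} k j → IsSignedPerm m σ →
  count (desNeg k j) (extensions m σ)
  ≡ ([ (desB σ ≡ᵇ k) ∧ (neg σ ≡ᵇ j) ]· suc (desB σ)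
     + [ (suc (desB σ) ≡ᵇ k) ∧ (neg σ ≡ᵇ j) ]· (m ∸ desB σ))
  + ([ (desB σ ≡ᵇ k) ∧ (suc (neg σ) ≡ᵇ j) ]· desB σ
     + [ (suc (desB σ) ≡ᵇ k) ∧ (suc (neg σ) ≡ᵇ j) ]· (suc m ∸ desB σ))
count-extensions {m} {σ} k j (refl , letters , _) =
  trans (count-++ (desNeg k j) (inserts (+ suc m) σ) _)
    (cong₂ _+_
      (count-profile {r = suc (desB σ)} {m ∸ desB σ} {desB σ} k j (neg-inserts (+ suc m))
        (descents-inserts-max (+ suc m) (+ 0) σ (ℤ.+<+ (s≤s z≤n) ∷ All.map Letter⇒<top letters)))
      (count-profile {r = desB σ} {suc m ∸ desB σ} {desB σ} k j (neg-inserts -[1+ m ])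
        (descents-inserts-min -[1+ m ] (+ 0) σ (ℤ.-<+ ∷ All.map Letter⇒>bottom letters))))
  where
  neg-inserts : ∀ a → All (λ w → neg w ≡ negative a + neg σ) (inserts a σ)
  neg-inserts a = All.tabulate (λ w∈ → neg-Insert (∈-inserts⁻ a σ w∈))

-- Unlike ⌊ _ ℕ.≟ _ ⌋, _≡ᵇ_ computes on suc, which makes the shifts k-1 and j-1 below definitional.
Bnum≡count : ∀ n k j → Bnum n k j ≡ count (desNeg k j) (signedPerms n)
Bnum≡count n k j = count-cong {xs = signedPerms n}
  (All.tabulate λ {σ} _ → cong₂ _∧_ (isYes≗does (desB σ ℕ.≟ k)) (isYes≗does (neg σ ℕ.≟ j)))

countWith : (List ℤ → ℕ) → (List ℤ → ℕ) → ℕ → ℕ → ℕ → ℕ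
countWith f g m k j = count (λ σ → (f σ ≡ᵇ k) ∧ (g σ ≡ᵇ j)) (signedPerms m)

Bnum-suc : ∀ m k j →
  Bnum (suc m) k j
  ≡ (suc k * countWith desB neg m k j + (suc m ∸ k) * countWith (suc ∘ desB) neg m k j)
    + (k * countWith desB (suc ∘ neg) m k j + (suc (suc m) ∸ k) * countWith (suc ∘ desB) (suc ∘ neg) m k j)
Bnum-suc m k j = begin
  Bnum (suc m) k j
    ≡⟨ Bnum≡count (suc m) k j ⟩
  count (desNeg k j) (signedPerms (suc m))
    ≡⟨ count-↭ (desNeg k j) (signedPerms-suc↭ m) ⟩
  count (desNeg k j) (concatMap (extensions m) S)
    ≡⟨ count-concatMap (desNeg k j) (extensions m) S ⟩
  sum (map (count (desNeg k j) ∘ extensions m) S)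
    ≡⟨ cong sum (map-cong-local {xs = S} (All.tabulate (count-extensions k j ∘ ∈-signedPerms⁻))) ⟩
  sum (map (λ σ → (w₁ σ + w₂ σ) + (w₃ σ + w₄ σ)) S)
    ≡⟨ sum-map-+ (λ σ → w₁ σ + w₂ σ) (λ σ → w₃ σ + w₄ σ) S ⟩
  sum (map (λ σ → w₁ σ + w₂ σ) S) + sum (map (λ σ → w₃ σ + w₄ σ) S)
    ≡⟨ cong₂ _+_ (sum-map-+ w₁ w₂ S) (sum-map-+ w₃ w₄ S) ⟩
  (sum (map w₁ S) + sum (map w₂ S)) + (sum (map w₃ S) + sum (map w₄ S))
    ≡⟨ cong₂ _+_ (cong₂ _+_ (sum-map-[≡ᵇ]· desB (λ σ → neg σ ≡ᵇ j) suc k S)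
                             (sum-map-[≡ᵇ]· (suc ∘ desB) (λ σ → neg σ ≡ᵇ j) (suc m ∸_) k S))
                  (cong₂ _+_ (sum-map-[≡ᵇ]· desB (λ σ → suc (neg σ) ≡ᵇ j) (λ d → d) k S)
                             (sum-map-[≡ᵇ]· (suc ∘ desB) (λ σ → suc (neg σ) ≡ᵇ j) (suc (suc m) ∸_) k S)) ⟩
  (suc k * countWith desB neg m k j + (suc m ∸ k) * countWith (suc ∘ desB) neg m k j)
    + (k * countWith desB (suc ∘ neg) m k j + (suc (suc m) ∸ k) * countWith (suc ∘ desB) (suc ∘ neg) m k j) ∎
  where
  open ≡-Reasoning
  S = signedPerms m
  w₁ w₂ w₃ w₄ : List ℤ → ℕ
  w₁ σ = [ (desB σ ≡ᵇ k) ∧ (neg σ ≡ᵇ j) ]· suc (desB σ)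
  w₂ σ = [ (suc (desB σ) ≡ᵇ k) ∧ (neg σ ≡ᵇ j) ]· (m ∸ desB σ)
  w₃ σ = [ (desB σ ≡ᵇ k) ∧ (suc (neg σ) ≡ᵇ j) ]· desB σ
  w₄ σ = [ (suc (desB σ) ≡ᵇ k) ∧ (suc (neg σ) ≡ᵇ j) ]· (suc m ∸ desB σ)

countWith-suc-desB-zero : ∀ g m j → countWith (suc ∘ desB) g m 0 j ≡ 0
countWith-suc-desB-zero g m j = count-none _ {signedPerms m} (All.tabulate λ _ ())

countWith-suc-neg-zero : ∀ f m k → countWith f (suc ∘ neg) m k 0 ≡ 0
countWith-suc-neg-zero f m k =
  count-none _ {signedPerms m} (All.tabulate λ {σ} _ → subst T (∧-zeroʳ (f σ ≡ᵇ k)))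

countWith-desB-large : ∀ g m {k} j → m < k → countWith desB g m k j ≡ 0
countWith-desB-large g m {k} j m<k = count-none _ {signedPerms m} (All.tabulate λ {σ} σ∈ t →
  let len , _ = ∈-signedPerms⁻ σ∈
      desB≡k  = ℕ.≡ᵇ⇒≡ (desB σ) k (proj₁ (Equivalence.to T-∧ t))
  in ℕ.<⇒≱ m<k (subst₂ _≤_ desB≡k len (descents-≤ (+ 0) σ)))

countWith-suc-desB-large : ∀ g m {k} j → suc m < k → countWith (suc ∘ desB) g m k j ≡ 0
countWith-suc-desB-large g m {suc k} j (s≤s m<k) = countWith-desB-large g m j m<k

P-coeff : ∀ m j k → + countWith desB neg m k j ≡ P m j k
P-coeff m j k = cong +_ (sym (Bnum≡count m k j))

X·P-coeff : ∀ m j k → + countWith (suc ∘ desB) neg m k j ≡ X· (P m j) k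
X·P-coeff m j zero    = cong +_ (countWith-suc-desB-zero neg m j)
X·P-coeff m j (suc k) = P-coeff m j k

Pprev-coeff : ∀ m j k → + countWith desB (suc ∘ neg) m k j ≡ Pprev m j k
Pprev-coeff m zero    k = cong +_ (countWith-suc-neg-zero desB m k)
Pprev-coeff m (suc j) k = P-coeff m j k

X·Pprev-coeff : ∀ m j k → + countWith (suc ∘ desB) (suc ∘ neg) m k j ≡ X· (Pprev m j) k
X·Pprev-coeff m j zero    = cong +_ (countWith-suc-desB-zero (suc ∘ neg) m j)
X·Pprev-coeff m j (suc k) = Pprev-coeff m j k

-- ∸ truncates at 0; harmless here because c vanishes whenever a < b.
pos-∸-* : ∀ a b c {x} → (a < b → c ≡ 0) → + c ≡ x → + ((a ∸ b) * c) ≡ (+ a ℤ.- + b) ℤ.* x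
pos-∸-* a b c vanish refl with b ℕ.≤? a
... | yes b≤a =
  trans (ℤ.pos-* (a ∸ b) c) (cong (ℤ._* + c) (trans (sym (ℤ.⊖-≥ b≤a)) (sym (ℤ.m-n≡m⊖n a b))))
... | no b≰a rewrite vanish (ℕ.≰⇒> b≰a) | ℕ.*-zeroʳ (a ∸ b) = sym (ℤ.*-zeroʳ (+ a ℤ.- + b))

P-suc-coeff : ∀ m j k →
  P (suc m) j k ≡ (+ suc k ℤ.* P m j k ℤ.+ (+ suc m ℤ.- + k) ℤ.* X· (P m j) k)
                  ℤ.+ (+ k ℤ.* Pprev m j k ℤ.+ (+ 1 ℤ.+ + suc m ℤ.- + k) ℤ.* X· (Pprev m j) k)
P-suc-coeff m j k =
  trans (cong +_ (Bnum-suc m k j))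
    (pos-+ (pos-+ (pos-* (suc k) (P-coeff m j k))
                  (pos-∸-* (suc m) k _ (countWith-suc-desB-large neg m j) (X·P-coeff m j k)))
           (pos-+ (pos-* k (Pprev-coeff m j k))
                  (pos-∸-* (suc (suc m)) k _
                           (countWith-suc-desB-large (suc ∘ neg) m j ∘ ℕ.<-trans (ℕ.n<1+n (suc m)))
                           (X·Pprev-coeff m j k))))
  where
  pos-+ : ∀ {a b x y} → + a ≡ x → + b ≡ y → + (a + b) ≡ x ℤ.+ y
  pos-+ {a} {b} refl refl = ℤ.pos-+ a b
  pos-* : ∀ a {c x} → + c ≡ x → + (a * c) ≡ + a ℤ.* x
  pos-* a {c} refl = ℤ.pos-* a c

recurrence-coeff : ∀ (c : ℤ) (p q : Poly) k →
  ((p ⊕ c ⊙ X· p ⊖ X· p) ⊕ (X· (D p) ⊖ X· (X· (D p))) ⊕ c ⊙ X· q ⊕ (X· (D q) ⊖ X· (X· (D q)))) k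
  ≡ (+ suc k ℤ.* p k ℤ.+ (c ℤ.- + k) ℤ.* X· p k) ℤ.+ (+ k ℤ.* q k ℤ.+ (+ 1 ℤ.+ c ℤ.- + k) ℤ.* X· q k)
recurrence-coeff c p q zero          = at-0 c (p 0) (q 0)
  where
  at-0 : ∀ c p₀ q₀ →
         ((p₀ ℤ.+ c ℤ.* + 0 ℤ.- + 0) ℤ.+ (+ 0 ℤ.- + 0)) ℤ.+ c ℤ.* + 0 ℤ.+ (+ 0 ℤ.- + 0)
         ≡ (+ 1 ℤ.* p₀ ℤ.+ (c ℤ.- + 0) ℤ.* + 0) ℤ.+ (+ 0 ℤ.* q₀ ℤ.+ (+ 1 ℤ.+ c ℤ.- + 0) ℤ.* + 0)
  at-0 = solve-∀
recurrence-coeff c p q (suc zero)    = at-1 c (p 0) (p 1) (q 0) (q 1)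
  where
  at-1 : ∀ c p₀ p₁ q₀ q₁ →
         ((p₁ ℤ.+ c ℤ.* p₀ ℤ.- p₀) ℤ.+ (+ 1 ℤ.* p₁ ℤ.- + 0)) ℤ.+ c ℤ.* q₀ ℤ.+ (+ 1 ℤ.* q₁ ℤ.- + 0)
         ≡ (+ 2 ℤ.* p₁ ℤ.+ (c ℤ.- + 1) ℤ.* p₀) ℤ.+ (+ 1 ℤ.* q₁ ℤ.+ (+ 1 ℤ.+ c ℤ.- + 1) ℤ.* q₀)
  at-1 = solve-∀
recurrence-coeff c p q (suc (suc k)) =
  at-2+ c (+ k) (p (suc k)) (p (suc (suc k))) (q (suc k)) (q (suc (suc k)))
  where
  at-2+ : ∀ c K p₁ p₂ q₁ q₂ →
          ((p₂ ℤ.+ c ℤ.* p₁ ℤ.- p₁) ℤ.+ ((+ 2 ℤ.+ K) ℤ.* p₂ ℤ.- (+ 1 ℤ.+ K) ℤ.* p₁))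
            ℤ.+ c ℤ.* q₁ ℤ.+ ((+ 2 ℤ.+ K) ℤ.* q₂ ℤ.- (+ 1 ℤ.+ K) ℤ.* q₁)
          ≡ ((+ 3 ℤ.+ K) ℤ.* p₂ ℤ.+ (c ℤ.- (+ 2 ℤ.+ K)) ℤ.* p₁)
            ℤ.+ ((+ 2 ℤ.+ K) ℤ.* q₂ ℤ.+ (+ 1 ℤ.+ c ℤ.- (+ 2 ℤ.+ K)) ℤ.* q₁)
  at-2+ = solve-∀

-- The cases neg = 0 and neg = n

withNeg : ℕ → ℕ → List (List ℤ)
withNeg n j = filter (λ σ → T? (neg σ ≡ᵇ j)) (signedPerms n)

∈-withNeg⁻ : ∀ {n j σ} → σ ∈ withNeg n j → IsSignedPerm n σ × neg σ ≡ j
∈-withNeg⁻ {n} {j} {σ} σ∈ with σ∈S , t ← ∈-filter⁻ (λ σ → T? (neg σ ≡ᵇ j)) {xs = signedPerms n} σ∈ =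
  ∈-signedPerms⁻ σ∈S , ℕ.≡ᵇ⇒≡ (neg σ) j t

∈-withNeg⁺ : ∀ {n j σ} → IsSignedPerm n σ → neg σ ≡ j → σ ∈ withNeg n j
∈-withNeg⁺ {n} {j} {σ} σ-perm neg≡j =
  ∈-filter⁺ (λ σ → T? (neg σ ≡ᵇ j)) (∈-signedPerms⁺ σ-perm) (ℕ.≡⇒≡ᵇ (neg σ) j neg≡j)

withNeg-unique : ∀ n j → Unique (withNeg n j)
withNeg-unique n j = Unique.filter⁺ (λ σ → T? (neg σ ≡ᵇ j)) (signedPerms-unique n)

withNeg-zero↭perms : ∀ n → withNeg n 0 ↭ perms n
withNeg-zero↭perms n = unique∧⇔⇒↭ (withNeg-unique n 0) (perms-unique n) to from
  where
  to : ∀ {σ} → σ ∈ withNeg n 0 → σ ∈ perms n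
  to {σ} σ∈ with (len , letters , d) , neg≡0 ← ∈-withNeg⁻ {n} σ∈ =
    ∈-perms⁺ {n} (len , All.zipWith (λ {x} → uncurry (∈-pos⇐ {x = x})) (letters , neg≡0⇒ σ neg≡0) , d)

  from : ∀ {τ} → τ ∈ perms n → τ ∈ withNeg n 0
  from τ∈ with len , τ⊆pos , d ← ∈-perms⁻ {n} τ∈ =
    ∈-withNeg⁺ {n} (len , All.map (λ {x} → proj₁ ∘ ∈-pos⇒ {x = x}) τ⊆pos , d)
               (neg≡0⇐ (All.map (λ {x} → proj₂ ∘ ∈-pos⇒ {x = x}) τ⊆pos))

Distinct-map-reflect : ∀ {n P} (f : ℤ → ℤ) → (∀ {x} → P x → Letter n x) →
                       (∀ {x} → P x → ∣ f x ∣ ≡ suc n ∸ ∣ x ∣) →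
                       ∀ {w} → All P w → Distinct w → Distinct (map f w)
Distinct-map-reflect f letter abs-f =
  AllPairs-map-All f λ px py x≢y fx≡fy →
    x≢y (reflect-injective (letter px) (letter py) (trans (sym (abs-f px)) (trans fx≡fy (abs-f py))))

raise : ℕ → ℤ → ℤ
raise n x = + suc n ℤ.+ x

lower : ℕ → ℤ → ℤ
lower n y = y ℤ.- + suc n

lower-raise : ∀ n x → lower n (raise n x) ≡ x
lower-raise n x = cancel (+ suc n) x
  where
  cancel : ∀ c x → (c ℤ.+ x) ℤ.- c ≡ x
  cancel = solve-∀

raise-lower : ∀ n y → raise n (lower n y) ≡ y
raise-lower n y = cancel (+ suc n) y
  where
  cancel : ∀ c y → c ℤ.+ (y ℤ.- c) ≡ y
  cancel = solve-∀

descents-raise : ∀ n w → descents (map (raise n) w) ≡ descents w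
descents-raise n []           = refl
descents-raise n (x ∷ [])     = refl
descents-raise n (x ∷ y ∷ ys) =
  cong₂ (λ b d → (if b then 1 else 0) + d) ⌊<?⌋-raise (descents-raise n (y ∷ ys))
  where
  ⌊<?⌋-raise : ⌊ raise n y ℤ.<? raise n x ⌋ ≡ ⌊ y ℤ.<? x ⌋
  ⌊<?⌋-raise with y ℤ.<? x
  ... | yes y<x = ⌊<?⌋-true (ℤ.+-monoʳ-< (+ suc n) y<x)
  ... | no  y≮x = ⌊<?⌋-false λ lt →
    y≮x (subst₂ ℤ._<_ (lower-raise n y) (lower-raise n x) (ℤ.+-monoˡ-< (ℤ.- + suc n) lt))

raise-letter : ∀ {n x} → Letter n x × negative x ≡ 1 → raise n x ≡ + (suc n ∸ ∣ x ∣)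
raise-letter {n} { -[1+ i ]} ((_ , i<n) , _) = ℤ.⊖-≥ (ℕ.m≤n⇒m≤1+n i<n)

lower-letter : ∀ {n y} → y ∈ pos n → lower n y ≡ ℤ.- + (suc n ∸ ∣ y ∣)
lower-letter {n} y∈ with i , i<n , refl ← ∈-pos⁻ y∈ = ℤ.⊖-≤ (s≤s (ℕ.<⇒≤ i<n))

negated-letter : ∀ {n a} → InRange n a → Letter n (ℤ.- + a) × negative (ℤ.- + a) ≡ 1
negated-letter {a = suc _} inRange = inRange , refl

withNeg-full↭perms : ∀ n → map (map (raise n)) (withNeg n n) ↭ perms n
withNeg-full↭perms n =
  unique∧⇔⇒↭ (Unique.map⁺ raise-injective (withNeg-unique n n)) (perms-unique n) to from
  where
  lower∘raise : ∀ σ → map (lower n) (map (raise n) σ) ≡ σ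
  lower∘raise σ = trans (sym (map-∘ σ)) (trans (map-cong (lower-raise n) σ) (map-id σ))

  raise∘lower : ∀ τ → map (raise n) (map (lower n) τ) ≡ τ
  raise∘lower τ = trans (sym (map-∘ τ)) (trans (map-cong (raise-lower n) τ) (map-id τ))

  raise-injective : ∀ {σ σ′} → map (raise n) σ ≡ map (raise n) σ′ → σ ≡ σ′
  raise-injective {σ} {σ′} eq =
    trans (sym (lower∘raise σ)) (trans (cong (map (lower n)) eq) (lower∘raise σ′))

  to : ∀ {τ} → τ ∈ map (map (raise n)) (withNeg n n) → τ ∈ perms n
  to τ∈ with σ , σ∈ , refl ← ∈-map⁻ _ τ∈ with (len , letters , d) , neg≡n ← ∈-withNeg⁻ {n} σ∈ =
    ∈-perms⁺ {n} (trans (length-map _ σ) len ,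
                  All-map⁺ (All.map (λ {x} p → subst (_∈ pos n) (sym (raise-letter {x = x} p))
                                                      (InRange⇒∈pos (InRange-reflect (proj₁ p)))) negLetters) ,
                  Distinct-map-reflect (raise n) proj₁ (λ {x} p → cong ∣_∣ (raise-letter {x = x} p)) negLetters d)
    where
    negLetters : All (λ x → Letter n x × negative x ≡ 1) σ
    negLetters = All.zip (letters , neg≡length⇒ σ (trans neg≡n (sym len)))

  from : ∀ {τ} → τ ∈ perms n → τ ∈ map (map (raise n)) (withNeg n n)
  from {τ} τ∈ with len , τ⊆pos , d ← ∈-perms⁻ {n} τ∈ =
    subst (_∈ map (map (raise n)) (withNeg n n)) (raise∘lower τ)
      (∈-map⁺ _ (∈-withNeg⁺ {n} (len′ , All.map proj₁ negLetters ,
                                  Distinct-map-reflect (lower n) (λ {y} → proj₁ ∘ ∈-pos⇒ {x = y}) abs-lower τ⊆pos d)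
                                 (trans (neg≡length⇐ (All.map proj₂ negLetters)) len′)))
    where
    len′ : length (map (lower n) τ) ≡ n
    len′ = trans (length-map _ τ) len

    abs-lower : ∀ {y} → y ∈ pos n → ∣ lower n y ∣ ≡ suc n ∸ ∣ y ∣
    abs-lower {y} y∈ = trans (cong ∣_∣ (lower-letter y∈)) (ℤ.∣-i∣≡∣i∣ (+ (suc n ∸ ∣ y ∣)))

    negLetters : All (λ x → Letter n x × negative x ≡ 1) (map (lower n) τ)
    negLetters = All-map⁺ (All.map (λ {y} y∈ →
      subst (λ z → Letter n z × negative z ≡ 1) (sym (lower-letter y∈))
            (negated-letter (InRange-reflect (proj₁ (∈-pos⇒ y∈))))) τ⊆pos)

Anum≡count : ∀ n k → Anum n k ≡ count (λ τ → descents τ ≡ᵇ k) (perms n)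
Anum≡count n k = count-cong {xs = perms n} (All.tabulate λ {τ} _ → isYes≗does (descents τ ℕ.≟ k))

P-neg-zero : ∀ n → P n 0 ≗ₚ PA n
P-neg-zero n k = cong +_ (begin
  Bnum n k 0
    ≡⟨ Bnum≡count n k 0 ⟩
  count (desNeg k 0) (signedPerms n)
    ≡⟨ count-∧ (λ σ → desB σ ≡ᵇ k) (λ σ → neg σ ≡ᵇ 0) (signedPerms n) ⟩
  count (λ σ → desB σ ≡ᵇ k) (withNeg n 0)
    ≡⟨ count-↭ (λ σ → desB σ ≡ᵇ k) (withNeg-zero↭perms n) ⟩
  count (λ τ → desB τ ≡ᵇ k) (perms n)
    ≡⟨ count-cong {xs = perms n} (All.tabulate λ τ∈ → cong (_≡ᵇ k) (desB-perm τ∈)) ⟩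
  count (λ τ → descents τ ≡ᵇ k) (perms n)
    ≡⟨ Anum≡count n k ⟨
  Anum n k ∎)
  where
  open ≡-Reasoning
  desB-perm : ∀ {τ} → τ ∈ perms n → desB τ ≡ descents τ
  desB-perm τ∈ =
    desB-nonnegative (All.map (λ {x} → proj₂ ∘ ∈-pos⇒ {x = x}) (proj₁ (proj₂ (∈-perms⁻ {n} τ∈))))

P-neg-full : ∀ n → 1 ≤ n → P n n ≗ₚ X· (PA n)
P-neg-full n 1≤n k = trans (cong +_ (Bnum-neg-full k)) (count-X· k)
  where
  open ≡-Reasoning
  desB-raise : ∀ {σ} → σ ∈ withNeg n n → desB σ ≡ suc (descents (map (raise n) σ))
  desB-raise {[]}    σ∈ with (len , _) , _ ← ∈-withNeg⁻ {n} σ∈ =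
    ⊥-elim (ℕ.1+n≰n (subst (1 ≤_) (sym len) 1≤n))
  desB-raise {x ∷ τ} σ∈ with (len , _) , neg≡n ← ∈-withNeg⁻ {n} σ∈ =
    trans (desB-negative {τ = τ} (All.head (neg≡length⇒ (x ∷ τ) (trans neg≡n (sym len)))))
          (cong suc (sym (descents-raise n (x ∷ τ))))

  Bnum-neg-full : ∀ k → Bnum n k n ≡ count (λ τ → suc (descents τ) ≡ᵇ k) (perms n)
  Bnum-neg-full k = begin
    Bnum n k n
      ≡⟨ Bnum≡count n k n ⟩
    count (desNeg k n) (signedPerms n)
      ≡⟨ count-∧ (λ σ → desB σ ≡ᵇ k) (λ σ → neg σ ≡ᵇ n) (signedPerms n) ⟩
    count (λ σ → desB σ ≡ᵇ k) (withNeg n n)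
      ≡⟨ count-cong {xs = withNeg n n} (All.tabulate λ σ∈ → cong (_≡ᵇ k) (desB-raise σ∈)) ⟩
    count (des+1≡ k ∘ map (raise n)) (withNeg n n)
      ≡⟨ count-map (des+1≡ k) (map (raise n)) (withNeg n n) ⟨
    count (des+1≡ k) (map (map (raise n)) (withNeg n n))
      ≡⟨ count-↭ (des+1≡ k) (withNeg-full↭perms n) ⟩
    count (des+1≡ k) (perms n) ∎
    where
    des+1≡ : ℕ → List ℤ → Bool
    des+1≡ k τ = suc (descents τ) ≡ᵇ k

  count-X· : ∀ k → + count (λ τ → suc (descents τ) ≡ᵇ k) (perms n) ≡ X· (PA n) k
  count-X· zero    = cong +_ (count-none _ {perms n} (All.tabulate λ _ ()))
  count-X· (suc k) = cong +_ (sym (Anum≡count n k))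

proposition3p1 : ((m j : ℕ) → j ≤ suc m →
                    P (suc m) j ≗ₚ
                      ((P m j ⊕ (+ suc m) ⊙ X· (P m j) ⊖ X· (P m j))
                       ⊕ (X· (D (P m j)) ⊖ X· (X· (D (P m j))))
                       ⊕ (+ suc m) ⊙ X· (Pprev m j)
                       ⊕ (X· (D (Pprev m j)) ⊖ X· (X· (D (Pprev m j))))))
                 × ((n : ℕ) → P n 0 ≗ₚ PA n)
                 × ((n : ℕ) → 1 ≤ n → P n n ≗ₚ X· (PA n))
proposition3p1 =
  (λ m j _ k → trans (P-suc-coeff m j k) (sym (recurrence-coeff (+ suc m) (P m j) (Pprev m j) k))) ,
  P-neg-zero ,
  P-neg-full
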